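{- Let $S$ be a sorting sequence with $r>1$ distinct values and multiplicities $p_1,\dots,p_r$, $p=\sum p_i$, $c=\gcd(p_1,\dots,p_r)$, $F_{\min}=\sum_{i=1}^r(i-1)p_i$, and let $k\ge1$. If there exists a general solution for $S$ with $f$ fake coins, where $f\le pk-(2p^2-p_1p-p_rp)/c+F_{\min}$, then there exists a general solution for $S$ with $f$ fake coins satisfying the height bound for $k$.
   Context: A sorting sequence of length $p$ is a non-decreasing sequence of $p$ non-negative integers beginning with $0$ in which each entry equals the previous one or exceeds it by $1$ (recording the outcome of sorting $p$ piles of $k$ coins by weight). If its distinct entries are $0,\dots,r-1$, let $p_i\ge1$ be the number of entries equal to $i-1$. A general solution with $f$ fake coins is an integer tuple $(f_1,\dots,f_r)$ with $0\le f_1<\dots<f_r$ and $\sum_i p_if_i=f$; it satisfies the height bound for $k$ if $f_r\le k$. -}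

module Defs where

open import Data.Nat using (ℕ; zero; suc; _+_; _*_; _∸_; _≤_; _<_; _≟_)
open import Data.Nat.GCD using (gcd)
open import Data.Nat.DivMod using (_/_)
open import Data.Fin using (Fin; toℕ; fromℕ<)
import Data.Fin
open import Data.List using (List; []; _∷_; length; map; upTo)
open import Data.Nat.ListAction using (sum)
open import Data.Product using (Σ; _×_; _,_)
open import Data.Integer using (ℤ; +_; -_) renaming (_+_ to _+ℤ_; _-_ to _-ℤ_; _*_ to _*ℤ_; _≤_ to _≤ℤ_)
open import Relation.Binary.PropositionalEquality using (_≡_)
open import Relation.Nullary using (yes; no)
open import Data.List using (foldr; allFin)
open import Data.Fin using (fromℕ)

data Steps : ℕ → List ℕ → Set where
  []   : ∀ {a} → Steps a []
  same : ∀ {a xs} → Steps a xs → Steps a (a ∷ xs)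
  up   : ∀ {a xs} → Steps (suc a) xs → Steps a (suc a ∷ xs)

data SortingSeq : List ℕ → Set where
  sortingSeq : ∀ {xs} → Steps 0 xs → SortingSeq (0 ∷ xs)

lastℕ : List ℕ → ℕ
lastℕ []           = 0
lastℕ (x ∷ [])     = x
lastℕ (_ ∷ y ∷ ys) = lastℕ (y ∷ ys)

-- number r of distinct values (entries are 0 , ... , r-1)
numValues : List ℕ → ℕ
numValues S = suc (lastℕ S)

count : ℕ → List ℕ → ℕ
count v []       = 0
count v (x ∷ xs) with v ≟ x
... | yes _ = suc (count v xs)
... | no  _ = count v xs

-- p_i (1-indexed) = number of entries equal to i-1.  Here mult S j = p_{j+1}.
mult : List ℕ → ℕ → ℕ
mult S j = count j S

gcdMult : List ℕ → ℕ
gcdMult S = foldr (λ j g → gcd (mult S j) g) 0 (upTo (numValues S))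

Fmin : List ℕ → ℕ
Fmin S = sum (map (λ j → j * mult S j) (upTo (numValues S)))

-- Σ_i p_i f_i for a tuple (f_1,...,f_r) given as g : Fin r → ℕ (g j = f_{j+1})
weightedSum : (S : List ℕ) → (Fin (numValues S) → ℕ) → ℕ
weightedSum S g = sum (map (λ i → mult S (toℕ i) * g i) (allFin (numValues S)))

-- a general solution for S with f fake coins: integers 0 ≤ f_1 < ... < f_r
-- (nonnegativity is built in by using ℕ) with Σ p_i f_i = f
record GeneralSolution (S : List ℕ) (f : ℕ) : Set where
  field
    tuple      : Fin (numValues S) → ℕ
    increasing : ∀ (i j : Fin (numValues S)) → i Data.Fin.< j → tuple i < tuple j
    total      : weightedSum S tuple ≡ f

HeightBound : (S : List ℕ) → ℕ → {f : ℕ} → GeneralSolution S f → Set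
HeightBound S k sol = GeneralSolution.tuple sol (fromℕ (lastℕ S)) ≤ k

-- exact-division helper: n ÷ c (c is always ≥ 1 here since every p_i ≥ 1)
_÷_ : ℕ → ℕ → ℕ
n ÷ zero  = 0
n ÷ suc c = n / suc c

fakeBound : List ℕ → ℕ → ℤ
fakeBound S k =
  ((+ (p * k)) -ℤ (+ ((2 * p * p ∸ mult S 0 * p ∸ mult S (lastℕ S) * p) ÷ gcdMult S)))
    +ℤ (+ Fmin S)
  where p = length S

-- Write an increasing tuple as f₁ < f₁ + 1 + δ₁ < f₁ + 2 + δ₁ + δ₂ < …  Then
-- Σ pᵢ fᵢ = f₁ P + F_min + Σⱼ δⱼ Tⱼ, where P = Σ pᵢ and Tⱼ = p_{j+1} + … + p_r, and the
-- height is f_r = f₁ + (r - 1) + Σ δⱼ.  Every Tⱼ is a multiple of c, so among any Q = P / c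
-- units of gap the prefix sums repeat modulo P and some consecutive block of them weighs a
-- multiple of P; moving that block into f₁ keeps f.  Once fewer than Q units remain, the
-- bound on f forces f_r ≤ k.

module Submission where

open import Data.Nat
open import Data.Nat.Properties
open import Data.Nat.DivMod using (_/_; _%_; _mod_; m≡m%n+[m/n]*n; m/n*n≡m; m*n/n≡m; m≥n⇒m/n>0)
open import Data.Nat.Divisibility
open import Data.Nat.GCD using (gcd; gcd[m,n]∣m; gcd[m,n]∣n)
open import Data.Nat.Induction using (<-wellFounded)
open import Data.Nat.ListAction using (sum)
open import Data.Nat.ListAction.Properties using (sum-++)
open import Data.Nat.Tactic.RingSolver using (solve-∀)
open import Algebra.Properties.Semiring.Sum +-*-semiring
  using (sum-syntax; ∑-distrib-+; sum-cong-≗; sum-replicate-zero) renaming (sum to ∑)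
open import Data.Fin as F using (Fin; zero; suc; toℕ; fromℕ; inject₁)
open import Data.Fin.Properties using (pigeonhole; toℕ<n; toℕ-fromℕ<; toℕ-fromℕ)
open import Data.List using (List; []; _∷_; _++_; length; map; take; drop; replicate; applyUpTo; foldr; tabulate)
open import Data.List.Properties
  using (map-++; map-cong; map-∘; map-tabulate; ++-assoc; length-++; length-take; length-drop; take-take; take++drop≡id)
open import Data.List.Relation.Unary.All as All using (All; []; _∷_)
open import Data.Product using (Σ; ∃; ∃₂; _×_; _,_)
open import Function using (_∘_; id)
open import Induction.WellFounded using (Acc; acc)
open import Relation.Binary.Core using (_Preserves_⟶_)
open import Relation.Binary.PropositionalEquality
open import Relation.Nullary using (yes; no; contradiction)
open import Data.Sum using (inj₁; inj₂)
open import Defs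

term≤∑ : ∀ {n} (f : Fin n → ℕ) i → f i ≤ ∑ f
term≤∑ f zero    = m≤m+n _ _
term≤∑ f (suc i) = ≤-trans (term≤∑ (f ∘ suc) i) (m≤n+m _ _)

∑-∣ : ∀ {d n} (f : Fin n → ℕ) → (∀ i → d ∣ f i) → d ∣ ∑ f
∑-∣ {n = zero}  f d∣f = _ ∣0
∑-∣ {n = suc n} f d∣f = ∣m∣n⇒∣m+n (d∣f zero) (∑-∣ (f ∘ suc) (d∣f ∘ suc))

n*b≤∑f : ∀ {n} b (f : Fin n → ℕ) → (∀ i → b ≤ f i) → n * b ≤ ∑ f
n*b≤∑f {zero}  b f b≤f = z≤n
n*b≤∑f {suc n} b f b≤f = +-mono-≤ (b≤f zero) (n*b≤∑f b (f ∘ suc) (b≤f ∘ suc))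

∑f*b≤∑[f*g] : ∀ {n} b (f g : Fin n → ℕ) → (∀ i → b ≤ g i) → ∑ f * b ≤ ∑[ i < n ] (f i * g i)
∑f*b≤∑[f*g] {zero}  b f g b≤g = z≤n
∑f*b≤∑[f*g] {suc n} b f g b≤g = begin
  (f zero + ∑ (f ∘ suc)) * b             ≡⟨ *-distribʳ-+ b (f zero) _ ⟩
  f zero * b + ∑ (f ∘ suc) * b
    ≤⟨ +-mono-≤ (*-monoʳ-≤ (f zero) (b≤g zero)) (∑f*b≤∑[f*g] b (f ∘ suc) (g ∘ suc) (b≤g ∘ suc)) ⟩
  f zero * g zero + ∑[ i < n ] (f (suc i) * g (suc i)) ∎
  where open ≤-Reasoning

module _ {X : Set} where

  sum-map-++ : (σ : X → ℕ) (A B : List X) → sum (map σ (A ++ B)) ≡ sum (map σ A) + sum (map σ B)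
  sum-map-++ σ A B = trans (cong sum (map-++ σ A B)) (sum-++ (map σ A) (map σ B))

  sum-map-*ʳ : (τ : X → ℕ) (c : ℕ) (L : List X) → sum (map (λ x → τ x * c) L) ≡ sum (map τ L) * c
  sum-map-*ʳ τ c []      = refl
  sum-map-*ʳ τ c (x ∷ L) = trans (cong (τ x * c +_) (sum-map-*ʳ τ c L)) (sym (*-distribʳ-+ c (τ x) _))

  sum-map-replicate : (σ : X → ℕ) (k : ℕ) (x : X) → sum (map σ (replicate k x)) ≡ k * σ x
  sum-map-replicate σ zero    x = refl
  sum-map-replicate σ (suc k) x = cong (σ x +_) (sum-map-replicate σ k x)

  sum-map-1≡length : (L : List X) → sum (map (λ _ → 1) L) ≡ length L
  sum-map-1≡length []      = refl
  sum-map-1≡length (x ∷ L) = cong suc (sum-map-1≡length L)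

  length-dropMiddle-< : (A B C : List X) → 0 < length B → length (A ++ C) < length (A ++ B ++ C)
  length-dropMiddle-< A B C |B|>0 = begin-strict
    length (A ++ C)                   ≡⟨ length-++ A ⟩
    length A + length C               <⟨ +-monoʳ-< (length A) (m<n+m (length C) |B|>0) ⟩
    length A + (length B + length C)  ≡⟨ cong (length A +_) (length-++ B) ⟨
    length A + length (B ++ C)        ≡⟨ length-++ A ⟨
    length (A ++ B ++ C)              ∎
    where open ≤-Reasoning

-- Segments of weight divisible by Q

[m+n]%o≡m%o⇒o∣n : ∀ m n {o} .{{_ : NonZero o}} → (m + n) % o ≡ m % o → o ∣ n
[m+n]%o≡m%o⇒o∣n m n {o} eq = ∣m+n∣m⇒∣n (subst (o ∣_) quotients (n∣m*n ((m + n) / o))) (n∣m*n (m / o))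
  where
  open ≡-Reasoning
  quotients : (m + n) / o * o ≡ m / o * o + n
  quotients = +-cancelˡ-≡ (m % o) _ _ (begin
    m % o + (m + n) / o * o        ≡⟨ cong (_+ (m + n) / o * o) eq ⟨
    (m + n) % o + (m + n) / o * o  ≡⟨ m≡m%n+[m/n]*n (m + n) o ⟨
    m + n                          ≡⟨ cong (_+ n) (m≡m%n+[m/n]*n m o) ⟩
    m % o + m / o * o + n          ≡⟨ +-assoc (m % o) _ n ⟩
    m % o + (m / o * o + n)        ∎)

module _ {X : Set} (τ : X → ℕ) {Q : ℕ} .{{_ : NonZero Q}} where

  -- Pigeonhole on the residues mod Q of the Q + 1 prefix sums of length ≤ Q.
  divisibleSegment : (L : List X) → Q ≤ length L →
    ∃₂ λ A B → ∃ λ C → L ≡ A ++ B ++ C × 0 < length B × Q ∣ sum (map τ B)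
  divisibleSegment L Q≤|L|
    with i , j , i<j , sameResidue ← pigeonhole (n<1+n Q) (λ i → sum (map τ (take (toℕ i) L)) mod Q)
    = A , B , C , decomposition , |B|>0 , Q∣B
    where
    open ≡-Reasoning
    i′ = toℕ i
    j′ = toℕ j
    j′≤|L| : j′ ≤ length L
    j′≤|L| = ≤-trans (s≤s⁻¹ (toℕ<n j)) Q≤|L|
    A = take i′ L
    B = drop i′ (take j′ L)
    C = drop j′ L
    prefix : take j′ L ≡ A ++ B
    prefix = begin
      take j′ L                                      ≡⟨ take++drop≡id i′ (take j′ L) ⟨
      take i′ (take j′ L) ++ B                       ≡⟨ cong (_++ B) (take-take i′ j′ L) ⟩
      take (i′ ⊓ j′) L ++ B                          ≡⟨ cong (λ t → take t L ++ B) (m≤n⇒m⊓n≡m (<⇒≤ i<j)) ⟩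
      A ++ B                                         ∎
    decomposition : L ≡ A ++ B ++ C
    decomposition = begin
      L                  ≡⟨ take++drop≡id j′ L ⟨
      take j′ L ++ C     ≡⟨ cong (_++ C) prefix ⟩
      (A ++ B) ++ C      ≡⟨ ++-assoc A B C ⟩
      A ++ B ++ C        ∎
    |B|>0 : 0 < length B
    |B|>0 = subst (0 <_) (sym |B|) (m<n⇒0<n∸m i<j)
      where
      |B| : length B ≡ j′ ∸ i′
      |B| = trans (length-drop i′ (take j′ L)) (cong (_∸ i′) (trans (length-take j′ L) (m≤n⇒m⊓n≡m j′≤|L|)))
    Q∣B : Q ∣ sum (map τ B)
    Q∣B = [m+n]%o≡m%o⇒o∣n (sum (map τ A)) _ (begin
      (sum (map τ A) + sum (map τ B)) % Q   ≡⟨ cong (_% Q) (trans (cong (sum ∘ map τ) prefix) (sum-map-++ τ A B)) ⟨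
      sum (map τ (take j′ L)) % Q           ≡⟨ toℕ-fromℕ< _ ⟨
      toℕ (sum (map τ (take j′ L)) mod Q)   ≡⟨ cong toℕ sameResidue ⟨
      toℕ (sum (map τ A) mod Q)             ≡⟨ toℕ-fromℕ< _ ⟩
      sum (map τ A) % Q                     ∎)

  reduceModulo : (L : List X) →
    ∃₂ λ m L′ → m * Q + sum (map τ L′) ≡ sum (map τ L) × length L′ < Q
  reduceModulo L = go L (<-wellFounded (length L))
    where
    go : (L : List X) → Acc _<_ (length L) →
      ∃₂ λ m L′ → m * Q + sum (map τ L′) ≡ sum (map τ L) × length L′ < Q
    go L (acc shorter) with length L <? Q
    ... | yes |L|<Q = 0 , L , refl , |L|<Q
    ... | no |L|≮Q with divisibleSegment L (≮⇒≥ |L|≮Q)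
    ... | A , B , C , refl , |B|>0 , divides q ΣB≡qQ
      with m , L′ , ΣL′ , |L′|<Q ← go (A ++ C) (shorter (length-dropMiddle-< A B C |B|>0))
      = q + m , L′ , weight , |L′|<Q
      where
      open ≡-Reasoning
      σ : List X → ℕ
      σ = sum ∘ map τ
      weight : (q + m) * Q + σ L′ ≡ σ (A ++ B ++ C)
      weight = begin
        (q + m) * Q + σ L′             ≡⟨ regroup q m Q (σ L′) ⟩
        q * Q + (m * Q + σ L′)         ≡⟨ cong (q * Q +_) (trans ΣL′ (sum-map-++ τ A C)) ⟩
        q * Q + (σ A + σ C)            ≡⟨ cong (_+ (σ A + σ C)) ΣB≡qQ ⟨
        σ B + (σ A + σ C)              ≡⟨ swap (σ A) (σ B) (σ C) ⟩
        σ A + (σ B + σ C)              ≡⟨ cong (σ A +_) (sum-map-++ τ B C) ⟨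
        σ A + σ (B ++ C)               ≡⟨ sum-map-++ τ A (B ++ C) ⟨
        σ (A ++ B ++ C)                ∎
        where
        regroup : ∀ q m Q s → (q + m) * Q + s ≡ q * Q + (m * Q + s)
        regroup = solve-∀
        swap : ∀ a b c → b + (a + c) ≡ a + (b + c)
        swap = solve-∀

-- Increasing tuples in gap form

fromGaps : ∀ {n} → ℕ → (Fin n → ℕ) → Fin (suc n) → ℕ
fromGaps         a δ zero    = a
fromGaps {suc n} a δ (suc i) = fromGaps (a + suc (δ zero)) (δ ∘ suc) i

gaps : ∀ {n} → (Fin (suc n) → ℕ) → Fin n → ℕ
gaps h j = h (suc j) ∸ suc (h (inject₁ j))

fromGaps-≥ : ∀ {n} a (δ : Fin n → ℕ) i → a ≤ fromGaps a δ i
fromGaps-≥         a δ zero    = ≤-refl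
fromGaps-≥ {suc n} a δ (suc i) = ≤-trans (m≤m+n a _) (fromGaps-≥ _ (δ ∘ suc) i)

fromGaps-increasing : ∀ {n} a (δ : Fin n → ℕ) → fromGaps a δ Preserves F._<_ ⟶ _<_
fromGaps-increasing {suc n} a δ {zero}  {suc j} _         = <-≤-trans (m<m+n a z<s) (fromGaps-≥ _ (δ ∘ suc) j)
fromGaps-increasing {suc n} a δ {suc i} {suc j} (s≤s i<j) = fromGaps-increasing _ (δ ∘ suc) i<j

fromGaps-gaps : ∀ {n} (h : Fin (suc n) → ℕ) → h Preserves F._<_ ⟶ _<_ → ∀ i → fromGaps (h zero) (gaps h) i ≡ h i
fromGaps-gaps         h inc zero    = refl
fromGaps-gaps {suc n} h inc (suc i) =
  trans (cong (λ a → fromGaps a (gaps h ∘ suc) i) (trans (+-suc (h zero) _) (m+[n∸m]≡n (inc {zero} {suc zero} z<s))))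
        (fromGaps-gaps (h ∘ suc) (λ i<j → inc (s<s i<j)) i)

fromGaps-last : ∀ {n} a (δ : Fin n → ℕ) → fromGaps a δ (fromℕ n) ≡ a + n + ∑ δ
fromGaps-last {zero}  a δ = sym (trans (+-identityʳ _) (+-identityʳ a))
fromGaps-last {suc n} a δ = trans (fromGaps-last _ (δ ∘ suc)) (regroup a (δ zero) n (∑ (δ ∘ suc)))
  where
  regroup : ∀ a d n s → a + suc d + n + s ≡ a + suc n + (d + s)
  regroup = solve-∀

tailSum : ∀ {n} → (Fin (suc n) → ℕ) → Fin n → ℕ
tailSum {suc n} p zero    = ∑ (p ∘ suc)
tailSum {suc n} p (suc j) = tailSum (p ∘ suc) j

tailSum-∣ : ∀ {n d} (p : Fin (suc n) → ℕ) → (∀ i → d ∣ p i) → ∀ j → d ∣ tailSum p j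
tailSum-∣ {suc n} p d∣p zero    = ∑-∣ (p ∘ suc) (d∣p ∘ suc)
tailSum-∣ {suc n} p d∣p (suc j) = tailSum-∣ (p ∘ suc) (d∣p ∘ suc) j

last≤tailSum : ∀ {n} (p : Fin (suc n) → ℕ) j → p (fromℕ n) ≤ tailSum p j
last≤tailSum {suc n} p zero    = term≤∑ (p ∘ suc) (fromℕ n)
last≤tailSum {suc n} p (suc j) = last≤tailSum (p ∘ suc) j

∑[toℕ*p]≡∑tailSum : ∀ {n} (p : Fin (suc n) → ℕ) → ∑[ i < suc n ] (toℕ i * p i) ≡ ∑ (tailSum p)
∑[toℕ*p]≡∑tailSum {zero}  p = refl
∑[toℕ*p]≡∑tailSum {suc n} p =
  trans (∑-distrib-+ (p ∘ suc) (λ i → toℕ i * p (suc i))) (cong (∑ (p ∘ suc) +_) (∑[toℕ*p]≡∑tailSum (p ∘ suc)))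

-- Abel summation: gap j is paid once for every coin above it.
∑-fromGaps : ∀ {n} (p : Fin (suc n) → ℕ) a δ →
  ∑[ i < suc n ] (p i * fromGaps a δ i) ≡ a * ∑ p + ∑ (tailSum p) + ∑[ j < n ] (δ j * tailSum p j)
∑-fromGaps {zero}  p a δ = regroup (p zero) a
  where
  regroup : ∀ p a → p * a + 0 ≡ a * (p + 0) + 0 + 0
  regroup = solve-∀
∑-fromGaps {suc n} p a δ =
  trans (cong (p zero * a +_) (∑-fromGaps (p ∘ suc) (a + suc (δ zero)) (δ ∘ suc)))
        (regroup (p zero) a (δ zero) (∑ (p ∘ suc)) (∑ (tailSum (p ∘ suc))) (∑[ j < n ] (δ (suc j) * tailSum (p ∘ suc) j)))
  where
  regroup : ∀ p a d s t u → p * a + ((a + suc d) * s + t + u) ≡ a * (p + s) + (s + t) + (d * s + u)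
  regroup = solve-∀

expand : ∀ {n} → (Fin n → ℕ) → List (Fin n)
expand {zero}  δ = []
expand {suc n} δ = replicate (δ zero) zero ++ map suc (expand (δ ∘ suc))

indicator : ∀ {n} → Fin n → Fin n → ℕ
indicator zero    zero    = 1
indicator zero    (suc _) = 0
indicator (suc _) zero    = 0
indicator (suc i) (suc j) = indicator i j

occurrences : ∀ {n} → List (Fin n) → Fin n → ℕ
occurrences []      j = 0
occurrences (x ∷ L) j = indicator x j + occurrences L j

sum-map-expand : ∀ {n} (σ : Fin n → ℕ) δ → sum (map σ (expand δ)) ≡ ∑[ j < n ] (δ j * σ j)
sum-map-expand {zero}  σ δ = refl
sum-map-expand {suc n} σ δ = begin
  sum (map σ (replicate (δ zero) zero ++ map suc (expand (δ ∘ suc))))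
    ≡⟨ sum-map-++ σ (replicate (δ zero) zero) _ ⟩
  sum (map σ (replicate (δ zero) zero)) + sum (map σ (map suc (expand (δ ∘ suc))))
    ≡⟨ cong₂ _+_ (sum-map-replicate σ (δ zero) zero) (cong sum (sym (map-∘ (expand (δ ∘ suc))))) ⟩
  δ zero * σ zero + sum (map (σ ∘ suc) (expand (δ ∘ suc)))
    ≡⟨ cong (δ zero * σ zero +_) (sum-map-expand (σ ∘ suc) (δ ∘ suc)) ⟩
  δ zero * σ zero + ∑[ j < n ] (δ (suc j) * σ (suc j))
    ∎
  where open ≡-Reasoning

∑-indicator : ∀ {n} (σ : Fin n → ℕ) x → ∑[ j < n ] (indicator x j * σ j) ≡ σ x
∑-indicator {suc n} σ zero    = trans (cong (σ zero + 0 +_) (sum-replicate-zero n)) (trans (+-identityʳ _) (+-identityʳ _))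
∑-indicator {suc n} σ (suc x) = ∑-indicator (σ ∘ suc) x

∑-occurrences : ∀ {n} (σ : Fin n → ℕ) L → ∑[ j < n ] (occurrences L j * σ j) ≡ sum (map σ L)
∑-occurrences {n} σ []      = sum-replicate-zero n
∑-occurrences {n} σ (x ∷ L) =
  trans (sum-cong-≗ (λ j → *-distribʳ-+ (σ j) (indicator x j) (occurrences L j)))
        (trans (∑-distrib-+ (λ j → indicator x j * σ j) (λ j → occurrences L j * σ j))
               (cong₂ _+_ (∑-indicator σ x) (∑-occurrences σ L)))

∑-occurrences≡length : ∀ {n} (L : List (Fin n)) → ∑ (occurrences L) ≡ length L
∑-occurrences≡length L =
  trans (sum-cong-≗ (λ j → sym (*-identityʳ (occurrences L j))))
        (trans (∑-occurrences (λ _ → 1) L) (sum-map-1≡length L))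

reduceGaps : ∀ {n Q c} .{{_ : NonZero Q}} .{{_ : NonZero c}} (σ : Fin n → ℕ) → (∀ j → c ∣ σ j) → (δ : Fin n → ℕ) →
  ∃₂ λ m δ′ → m * (Q * c) + ∑[ j < n ] (δ′ j * σ j) ≡ ∑[ j < n ] (δ j * σ j) × ∑ δ′ < Q
reduceGaps {n} {Q} {c} σ c∣σ δ
  with m , L′ , reduced , |L′|<Q ← reduceModulo (λ j → σ j / c) {Q} (expand δ)
  = m , occurrences L′ , weight , subst (_< Q) (sym (∑-occurrences≡length L′)) |L′|<Q
  where
  open ≡-Reasoning
  τ : Fin n → ℕ
  τ j = σ j / c
  sum-map-σ : ∀ L → sum (map σ L) ≡ sum (map τ L) * c
  sum-map-σ L = trans (cong sum (map-cong (λ j → sym (m/n*n≡m (c∣σ j))) L)) (sum-map-*ʳ τ c L)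
  weight : m * (Q * c) + ∑[ j < n ] (occurrences L′ j * σ j) ≡ ∑[ j < n ] (δ j * σ j)
  weight = begin
    m * (Q * c) + ∑[ j < n ] (occurrences L′ j * σ j)
      ≡⟨ cong₂ _+_ (sym (*-assoc m Q c)) (trans (∑-occurrences σ L′) (sum-map-σ L′)) ⟩
    m * Q * c + sum (map τ L′) * c  ≡⟨ *-distribʳ-+ c (m * Q) _ ⟨
    (m * Q + sum (map τ L′)) * c    ≡⟨ cong (_* c) reduced ⟩
    sum (map τ (expand δ)) * c      ≡⟨ sum-map-σ (expand δ) ⟨
    sum (map σ (expand δ))          ≡⟨ sum-map-expand σ δ ⟩
    ∑[ j < n ] (δ j * σ j)          ∎

-- With p₀, pₗ the first and last multiplicities and M the inner ones, 2P - p₀ - pₗ = P + M.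
[2P²∸p₀P∸pₗP]/c≡[P+M]Q : ∀ {p₀ pₗ M P Q c} .{{_ : NonZero c}} → P ≡ p₀ + (pₗ + M) → Q * c ≡ P →
  (2 * P * P ∸ p₀ * P ∸ pₗ * P) / c ≡ (P + M) * Q
[2P²∸p₀P∸pₗP]/c≡[P+M]Q {p₀} {pₗ} {M} {_} {Q} {c} refl Q*c≡P = begin
  (2 * P * P ∸ p₀ * P ∸ pₗ * P) / c  ≡⟨ cong (_/ c) excess ⟩
  (P + M) * P / c                    ≡⟨ cong (λ t → (P + M) * t / c) Q*c≡P ⟨
  (P + M) * (Q * c) / c              ≡⟨ cong (_/ c) (*-assoc (P + M) Q c) ⟨
  (P + M) * Q * c / c                ≡⟨ m*n/n≡m ((P + M) * Q) c ⟩
  (P + M) * Q                        ∎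
  where
  open ≡-Reasoning
  P = p₀ + (pₗ + M)
  split : ∀ p₀ pₗ M → 2 * (p₀ + (pₗ + M)) * (p₀ + (pₗ + M))
    ≡ p₀ * (p₀ + (pₗ + M)) + (pₗ * (p₀ + (pₗ + M)) + (p₀ + (pₗ + M) + M) * (p₀ + (pₗ + M)))
  split = solve-∀
  excess : 2 * P * P ∸ p₀ * P ∸ pₗ * P ≡ (P + M) * P
  excess = trans (cong (λ t → t ∸ p₀ * P ∸ pₗ * P) (split p₀ pₗ M))
                 (trans (cong (_∸ pₗ * P) (m+n∸m≡n (p₀ * P) _)) (m+n∸m≡n (pₗ * P) _))

a+n+l≤k : ∀ {a n l p₀ pₗ M P Q c k S} → P ≡ p₀ + (pₗ + M) → Q * c ≡ P → .{{_ : NonZero P}} →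
  n * c ≤ pₗ + M → l ≤ Q → l * pₗ ≤ S → a * P + S + (P + M) * Q ≤ P * k → a + n + l ≤ k
a+n+l≤k {a} {n} {l} {p₀} {pₗ} {M} {_} {Q} {c} {k} {S} refl Q*c≡P n*c≤ l≤Q l*pₗ≤S bound =
  *-cancelˡ-≤ P (begin
    P * (a + n + l)                              ≡⟨ distribute a n l p₀ pₗ M ⟩
    a * P + (l * pₗ + ((p₀ + M) * l + n * P))
      ≤⟨ +-monoʳ-≤ (a * P) (+-mono-≤ l*pₗ≤S (+-mono-≤ (*-monoʳ-≤ (p₀ + M) l≤Q) n*P≤)) ⟩
    a * P + (S + ((p₀ + M) * Q + (pₗ + M) * Q))  ≡⟨ collect a S p₀ pₗ M Q ⟩
    a * P + S + (P + M) * Q                      ≤⟨ bound ⟩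
    P * k                                        ∎)
  where
  open ≤-Reasoning
  P = p₀ + (pₗ + M)
  n*P≤ : n * P ≤ (pₗ + M) * Q
  n*P≤ = begin
    n * P        ≡⟨ cong (n *_) Q*c≡P ⟨
    n * (Q * c)  ≡⟨ swap n Q c ⟩
    n * c * Q    ≤⟨ *-monoˡ-≤ Q n*c≤ ⟩
    (pₗ + M) * Q ∎
    where
    swap : ∀ n Q c → n * (Q * c) ≡ n * c * Q
    swap = solve-∀
  distribute : ∀ a n l p₀ pₗ M → (p₀ + (pₗ + M)) * (a + n + l)
    ≡ a * (p₀ + (pₗ + M)) + (l * pₗ + ((p₀ + M) * l + n * (p₀ + (pₗ + M))))
  distribute = solve-∀
  collect : ∀ a S p₀ pₗ M Q → a * (p₀ + (pₗ + M)) + (S + ((p₀ + M) * Q + (pₗ + M) * Q))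
    ≡ a * (p₀ + (pₗ + M)) + S + (p₀ + (pₗ + M) + M) * Q
  collect = solve-∀

last≤∑tail : ∀ {n} (p : Fin (suc n) → ℕ) → 1 ≤ n → p (fromℕ n) ≤ ∑ (p ∘ suc)
last≤∑tail {suc n} p _ = last≤tailSum p zero

module _ {n : ℕ} (p : Fin (suc n) → ℕ) {c : ℕ} .{{_ : NonZero c}}
         (p≥1 : ∀ i → 1 ≤ p i) (c∣p : ∀ i → c ∣ p i) where

  private
    P = ∑ p
    p₀ = p zero
    pₗ = p (fromℕ n)
    σ = tailSum p
    Q = P / c

    instance
      P≢0 : NonZero P
      P≢0 = >-nonZero (≤-trans (p≥1 zero) (m≤m+n p₀ _))
      Q≢0 : NonZero Q
      Q≢0 = >-nonZero (m≥n⇒m/n>0 (∣⇒≤ (∑-∣ p c∣p)))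

    Q*c≡P : Q * c ≡ P
    Q*c≡P = m/n*n≡m (∑-∣ p c∣p)

  boundedSolution : 1 ≤ n → ∀ {k f} (h : Fin (suc n) → ℕ) → h Preserves F._<_ ⟶ _<_ →
    ∑[ i < suc n ] (p i * h i) ≡ f →
    f + (2 * ∑ p * ∑ p ∸ p zero * ∑ p ∸ p (fromℕ n) * ∑ p) / c ≤ ∑ p * k + ∑[ i < suc n ] (toℕ i * p i) →
    ∃ λ h′ → h′ Preserves F._<_ ⟶ _<_ × ∑[ i < suc n ] (p i * h′ i) ≡ f × h′ (fromℕ n) ≤ k
  boundedSolution 1≤n {k} {f} h h-increasing total bound
    with m , δ′ , reduced , ∑δ′<Q ← reduceGaps {Q = Q} σ (tailSum-∣ p c∣p) (gaps h)
    = fromGaps a δ′ , fromGaps-increasing a δ′ , trans (∑-fromGaps p a δ′) (sym f≡) , height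
    where
    a = h zero + m
    F = ∑ σ
    S = ∑[ j < n ] (δ′ j * σ j)
    M = ∑ (p ∘ suc) ∸ pₗ
    P≡ : P ≡ p₀ + (pₗ + M)
    P≡ = cong (p₀ +_) (sym (m+[n∸m]≡n (last≤∑tail p 1≤n)))

    f≡ : f ≡ a * P + F + S
    f≡ = begin
      f                                                ≡⟨ total ⟨
      ∑[ i < suc n ] (p i * h i)                       ≡⟨ sum-cong-≗ (λ i → cong (p i *_) (fromGaps-gaps h h-increasing i)) ⟨
      ∑[ i < suc n ] (p i * fromGaps (h zero) (gaps h) i)  ≡⟨ ∑-fromGaps p (h zero) (gaps h) ⟩
      h zero * P + F + ∑[ j < n ] (gaps h j * σ j)     ≡⟨ cong (h zero * P + F +_) reduced ⟨
      h zero * P + F + (m * (Q * c) + S)               ≡⟨ cong (λ t → h zero * P + F + (m * t + S)) Q*c≡P ⟩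
      h zero * P + F + (m * P + S)                     ≡⟨ regroup (h zero) m P F S ⟩
      a * P + F + S                                    ∎
      where
      open ≡-Reasoning
      regroup : ∀ h m P F S → h * P + F + (m * P + S) ≡ (h + m) * P + F + S
      regroup = solve-∀

    reducedBound : a * P + S + (P + M) * Q ≤ P * k
    reducedBound = +-cancelʳ-≤ F _ _ (begin
      a * P + S + (P + M) * Q + F  ≡⟨ regroup (a * P) F S ((P + M) * Q) ⟩
      a * P + F + S + (P + M) * Q  ≡⟨ cong₂ _+_ f≡ ([2P²∸p₀P∸pₗP]/c≡[P+M]Q {p₀ = p₀} {pₗ = pₗ} P≡ Q*c≡P) ⟨
      f + (2 * P * P ∸ p₀ * P ∸ pₗ * P) / c  ≤⟨ bound ⟩
      P * k + ∑[ i < suc n ] (toℕ i * p i)   ≡⟨ cong (P * k +_) (∑[toℕ*p]≡∑tailSum p) ⟩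
      P * k + F                    ∎)
      where
      open ≤-Reasoning
      regroup : ∀ x F S y → x + S + y + F ≡ x + F + S + y
      regroup = solve-∀

    n*c≤pₗ+M : n * c ≤ pₗ + M
    n*c≤pₗ+M = subst (n * c ≤_) (sym (m+[n∸m]≡n (last≤∑tail p 1≤n)))
      (n*b≤∑f c (p ∘ suc) (λ i → ∣⇒≤ {{>-nonZero (p≥1 (suc i))}} (c∣p (suc i))))

    height : fromGaps a δ′ (fromℕ n) ≤ k
    height = subst (_≤ k) (sym (fromGaps-last a δ′))
      (a+n+l≤k {a = a} {n = n} {p₀ = p₀} P≡ Q*c≡P n*c≤pₗ+M (<⇒≤ ∑δ′<Q)
               (∑f*b≤∑[f*g] pₗ δ′ σ (last≤tailSum p)) reducedBound)

-- Sorting sequences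

count-∷ : ∀ v x xs → count v (x ∷ xs) ≡ count v (x ∷ []) + count v xs
count-∷ v x xs with v ≟ x
... | yes _ = refl
... | no  _ = refl

count-suc : ∀ v x → count (suc v) (suc x ∷ []) ≡ count v (x ∷ [])
count-suc v x with suc v ≟ suc x | v ≟ x
... | yes _      | yes _   = refl
... | no  _      | no  _   = refl
... | yes 1+v≡1+x | no v≢x = contradiction (suc-injective 1+v≡1+x) v≢x
... | no 1+v≢1+x  | yes v≡x = contradiction (cong suc v≡x) 1+v≢1+x

∑-count-singleton : ∀ r x → x < r → ∑[ i < r ] count (toℕ i) (x ∷ []) ≡ 1
∑-count-singleton (suc r) zero    _         = cong suc (sum-replicate-zero r)
∑-count-singleton (suc r) (suc x) (s≤s x<r) =
  trans (sum-cong-≗ {r} (λ i → count-suc (toℕ i) x)) (∑-count-singleton r x x<r)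

∑-count≡length : ∀ r xs → All (_< r) xs → ∑[ i < r ] count (toℕ i) xs ≡ length xs
∑-count≡length r []       []           = sum-replicate-zero r
∑-count≡length r (x ∷ xs) (x<r ∷ xs<r) = begin
  ∑[ i < r ] count (toℕ i) (x ∷ xs)
    ≡⟨ sum-cong-≗ {r} (λ i → count-∷ (toℕ i) x xs) ⟩
  ∑[ i < r ] (count (toℕ i) (x ∷ []) + count (toℕ i) xs)
    ≡⟨ ∑-distrib-+ {r} (λ i → count (toℕ i) (x ∷ [])) (λ i → count (toℕ i) xs) ⟩
  ∑[ i < r ] count (toℕ i) (x ∷ []) + ∑[ i < r ] count (toℕ i) xs
    ≡⟨ cong₂ _+_ (∑-count-singleton r x x<r) (∑-count≡length r xs xs<r) ⟩
  suc (length xs)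
    ∎
  where open ≡-Reasoning

count-head : ∀ v xs → 1 ≤ count v (v ∷ xs)
count-head v xs with v ≟ v
... | yes _   = s≤s z≤n
... | no v≢v = contradiction refl v≢v

count-∷-≥ : ∀ v x xs → count v xs ≤ count v (x ∷ xs)
count-∷-≥ v x xs = subst (count v xs ≤_) (sym (count-∷ v x xs)) (m≤n+m _ _)

steps-count-positive : ∀ {a xs j} → Steps a xs → a ≤ j → j ≤ lastℕ (a ∷ xs) → 1 ≤ count j (a ∷ xs)
steps-count-positive {j = j} [] a≤j j≤a =
  subst (λ a → 1 ≤ count j (a ∷ [])) (≤-antisym j≤a a≤j) (count-head j [])
steps-count-positive {a} {j = j} (same steps) a≤j j≤last =
  ≤-trans (steps-count-positive steps a≤j j≤last) (count-∷-≥ j a _)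
steps-count-positive {a} {j = j} (up steps) a≤j j≤last with m≤n⇒m<n∨m≡n a≤j
... | inj₁ a<j  = ≤-trans (steps-count-positive steps a<j j≤last) (count-∷-≥ j a _)
... | inj₂ refl = count-head a _

steps-bounded : ∀ {a xs} → Steps a xs → All (_≤ lastℕ (a ∷ xs)) (a ∷ xs)
steps-bounded []           = ≤-refl ∷ []
steps-bounded (same steps) = All.head (steps-bounded steps) ∷ steps-bounded steps
steps-bounded (up steps)   = <⇒≤ (All.head (steps-bounded steps)) ∷ steps-bounded steps

multiplicities : (S : List ℕ) → Fin (numValues S) → ℕ
multiplicities S i = mult S (toℕ i)

multiplicities-positive : ∀ {S} → SortingSeq S → ∀ i → 1 ≤ multiplicities S i
multiplicities-positive (sortingSeq steps) i = steps-count-positive steps z≤n (s≤s⁻¹ (toℕ<n i))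

length≡∑multiplicities : ∀ {S} → SortingSeq S → length S ≡ ∑ (multiplicities S)
length≡∑multiplicities {S} (sortingSeq steps) =
  sym (∑-count≡length (numValues S) S (All.map s≤s (steps-bounded steps)))

foldr-gcd-∣ : ∀ r (g F : ℕ → ℕ) (i : Fin r) → foldr (λ j d → gcd (F j) d) 0 (applyUpTo g r) ∣ F (g (toℕ i))
foldr-gcd-∣ (suc r) g F zero    = gcd[m,n]∣m (F (g 0)) _
foldr-gcd-∣ (suc r) g F (suc i) = ∣-trans (gcd[m,n]∣n (F (g 0)) _) (foldr-gcd-∣ r (g ∘ suc) F i)

gcdMult-∣ : ∀ S i → gcdMult S ∣ multiplicities S i
gcdMult-∣ S = foldr-gcd-∣ (numValues S) id (mult S)

gcdMult≢0 : ∀ {S} → SortingSeq S → NonZero (gcdMult S)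
gcdMult≢0 {S} seq = ≢-nonZero λ c≡0 →
  <⇒≢ (multiplicities-positive seq zero) (sym (0∣⇒≡0 (subst (_∣ mult S 0) c≡0 (gcdMult-∣ S zero))))

sum-map-applyUpTo : ∀ r (g F : ℕ → ℕ) → sum (map F (applyUpTo g r)) ≡ ∑[ i < r ] F (g (toℕ i))
sum-map-applyUpTo zero    g F = refl
sum-map-applyUpTo (suc r) g F = cong (F (g 0) +_) (sum-map-applyUpTo r (g ∘ suc) F)

Fmin≡∑ : ∀ S → Fmin S ≡ ∑[ i < numValues S ] (toℕ i * multiplicities S i)
Fmin≡∑ S = sum-map-applyUpTo (numValues S) id (λ j → j * mult S j)

sum-tabulate : ∀ {n} (f : Fin n → ℕ) → sum (tabulate f) ≡ ∑ f
sum-tabulate {zero}  f = refl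
sum-tabulate {suc n} f = cong (f zero +_) (sum-tabulate (f ∘ suc))

weightedSum≡∑ : ∀ S g → weightedSum S g ≡ ∑[ i < numValues S ] (multiplicities S i * g i)
weightedSum≡∑ S g = trans (cong sum (map-tabulate id (λ i → multiplicities S i * g i))) (sum-tabulate (λ i → multiplicities S i * g i))

open import Data.Integer as ℤ using (+_) renaming (_≤_ to _≤ℤ_)
import Data.Integer.Properties as ℤ
open import Data.Integer.Tactic.RingSolver using () renaming (solve-∀ to ℤ-solve-∀)

÷≡/ : ∀ m c .{{_ : NonZero c}} → m ÷ c ≡ m / c
÷≡/ m (suc c) = refl

+f≤+a-+x++b⇒f+x≤a+b : ∀ f a x b → + f ≤ℤ + a ℤ.- + x ℤ.+ + b → f + x ≤ a + b
+f≤+a-+x++b⇒f+x≤a+b f a x b bound =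
  ℤ.drop‿+≤+ (subst (+ (f + x) ≤ℤ_) (cancel (+ a) (+ x) (+ b)) (ℤ.+-monoˡ-≤ (+ x) bound))
  where
  cancel : ∀ a x b → a ℤ.- x ℤ.+ b ℤ.+ x ≡ a ℤ.+ b
  cancel = ℤ-solve-∀

≤fakeBound⇒ : ∀ {S k f} .{{_ : NonZero (gcdMult S)}} → SortingSeq S → + f ≤ℤ fakeBound S k →
  let p = multiplicities S ; P = ∑ p in
  f + (2 * P * P ∸ p zero * P ∸ p (fromℕ (lastℕ S)) * P) / gcdMult S ≤ P * k + ∑[ i < numValues S ] (toℕ i * p i)
≤fakeBound⇒ {S} {k} {f} seq bound = begin
  f + (2 * P * P ∸ p₀ * P ∸ pₗ * P) / c
    ≡⟨ cong (λ t → f + t) (÷≡/ _ c) ⟨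
  f + (2 * P * P ∸ p₀ * P ∸ pₗ * P) ÷ c
    ≡⟨ cong₂ (λ L pₗ → f + (2 * L * L ∸ p₀ * L ∸ pₗ * L) ÷ c)
             (length≡∑multiplicities seq) (cong (mult S) (sym (toℕ-fromℕ (lastℕ S)))) ⟨
  f + (2 * L * L ∸ p₀ * L ∸ mult S (lastℕ S) * L) ÷ c
    ≤⟨ +f≤+a-+x++b⇒f+x≤a+b f (L * k) _ (Fmin S) bound ⟩
  L * k + Fmin S
    ≡⟨ cong₂ (λ L F → L * k + F) (length≡∑multiplicities seq) (Fmin≡∑ S) ⟩
  P * k + ∑[ i < numValues S ] (toℕ i * p i)
    ∎
  where
  open ≤-Reasoning
  p = multiplicities S
  p₀ = p zero
  pₗ = p (fromℕ (lastℕ S))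
  P = ∑ p
  L = length S
  c = gcdMult S

mainTheorem10 : (S : List ℕ) → SortingSeq S → 1 < numValues S → (k : ℕ) → 1 ≤ k →
    (f : ℕ) → GeneralSolution S f → (+ f) ≤ℤ fakeBound S k →
    Σ (GeneralSolution S f) (λ sol → HeightBound S k sol)
mainTheorem10 S seq r>1 k _ f sol bound =
  let h′ , h′-increasing , total′ , height =
        boundedSolution (multiplicities S) (multiplicities-positive seq) (gcdMult-∣ S) (s≤s⁻¹ r>1)
          tuple (λ {i} {j} → increasing i j) (trans (sym (weightedSum≡∑ S tuple)) total) (≤fakeBound⇒ seq bound)
  in record { tuple = h′ ; increasing = λ i j → h′-increasing ; total = trans (weightedSum≡∑ S h′) total′ } , height
  where
  open GeneralSolution sol
  instance
    gcdMult-nonZero : NonZero (gcdMult S)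
    gcdMult-nonZero = gcdMult≢0 seq
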